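{- For every $n\geq 0$, the map $\psi$ restricts to a bijection from $\mathcal{C}_n$ onto the set of Motzkin paths of length $n$ that contain no occurrence of the pattern $UU$, where $\mathcal{C}_n$ is the set of Łukasiewicz paths of length $n$ having no flat step at positive height and in which every up step $U_k$ ($k\geq1$) is immediately followed by a down step $D$.
   Context: A Łukasiewicz path of length $n$ is a sequence of $n$ steps from $\{(1,i): i\geq -1\}$ starting at $(0,0)$, ending at $(n,0)$ and never going below the $x$-axis; a Motzkin path is one with steps in $\{U,F,D\}$. Write $D=(1,-1)$, $F=(1,0)$, $U=U_1=(1,1)$, $U_k=(1,k)$; $\epsilon$ is the empty path. The height of a step is the minimal ordinate of its endpoints. Every nonempty Łukasiewicz path is uniquely either $FL$ or $U_kL_1DL_2D\cdots L_kDL$ with $k\geq1$ and $L,L_1,\dots,L_k$ Łukasiewicz paths. The map $\psi$ is defined recursively by $\psi(\epsilon)=\epsilon$, $\psi(FL)=F\psi(L)$, $\psi(U_kL_1DL_2D\cdots L_kDL)=U\psi(L_1)F\psi(L_2)F\cdots F\psi(L_k)D\psi(L)$. -}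

module Defs where

open import Data.Nat using (ℕ; zero; suc; _+_; _∸_)
open import Data.List using (List; []; _∷_; _++_; length; map; concat; intersperse; [_])
open import Data.Product using (_×_; _,_; ∃-syntax)
open import Data.Unit using (⊤)
open import Data.Empty using (⊥)
open import Relation.Binary.PropositionalEquality using (_≡_)

-- Steps.
-- A Łukasiewicz step (1,i), i ≥ -1:
--   D      = (1,-1)
--   F      = (1,0)
--   U↑ k   = U_{k+1} = (1, k+1)      (so U↑ 0 = U = U_1)
data LStep : Set where
  D F : LStep
  U↑  : ℕ → LStep

data MStep : Set where
  U F D : MStep

embed : MStep → LStep
embed U = U↑ 0
embed F = F
embed D = D

-- Paths.
-- Walk h s : the step sequence s, started at height h, never goes
-- below the x-axis and ends at height 0.
data Walk : ℕ → List LStep → Set where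
  end  : Walk 0 []
  stepD : ∀ {h s} → Walk h s → Walk (suc h) (D ∷ s)
  stepF : ∀ {h s} → Walk h s → Walk h (F ∷ s)
  stepU : ∀ {h k s} → Walk (suc k + h) s → Walk h (U↑ k ∷ s)

IsLuk : ℕ → List LStep → Set
IsLuk n s = length s ≡ n × Walk 0 s

IsMotzkin : ℕ → List MStep → Set
IsMotzkin n m = length m ≡ n × Walk 0 (map embed m)

-- No flat step at positive height (h = current height; the height of
-- a flat step is its ordinate).
NoFlatPos : ℕ → List LStep → Set
NoFlatPos h []         = ⊤
NoFlatPos h (F ∷ s)    = h ≡ 0 × NoFlatPos h s
NoFlatPos h (D ∷ s)    = NoFlatPos (h ∸ 1) s
NoFlatPos h (U↑ k ∷ s) = NoFlatPos (suc k + h) s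

UpThenD : List LStep → Set
UpThenD []                  = ⊤
UpThenD (D ∷ s)             = UpThenD s
UpThenD (F ∷ s)             = UpThenD s
UpThenD (U↑ k ∷ [])         = ⊥
UpThenD (U↑ k ∷ D ∷ s)      = UpThenD (D ∷ s)
UpThenD (U↑ k ∷ F ∷ s)      = ⊥
UpThenD (U↑ k ∷ U↑ j ∷ s)   = ⊥

InC : ℕ → List LStep → Set
InC n s = IsLuk n s × NoFlatPos 0 s × UpThenD s

NoUU : List MStep → Set
NoUU []            = ⊤
NoUU (U ∷ U ∷ s)   = ⊥
NoUU (U ∷ s)       = NoUU s
NoUU (F ∷ s)       = NoUU s
NoUU (D ∷ s)       = NoUU s

InM : ℕ → List MStep → Set
InM n m = IsMotzkin n m × NoUU m

private
  cons₁ : {A B : Set} → A → List A × B → List A × B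
  cons₁ x (xs , r) = (x ∷ xs , r)

-- firstReturn h s = (P , R) where P is the longest prefix of s that,
-- started at relative height h, does not go below relative height 0,
-- and s = P ++ D ∷ R (the D being the first step going below 0);
-- if no such D exists, R = [].
firstReturn : ℕ → List LStep → List LStep × List LStep
firstReturn h       []         = [] , []
firstReturn zero    (D ∷ s)    = [] , s
firstReturn (suc h) (D ∷ s)    = cons₁ D (firstReturn h s)
firstReturn h       (F ∷ s)    = cons₁ F (firstReturn h s)
firstReturn h       (U↑ k ∷ s) = cons₁ (U↑ k) (firstReturn (suc k + h) s)

-- pieces k s = ((L₁ ∷ ⋯ ∷ L_k) , L)  when  s = L₁ D L₂ D ⋯ L_k D L.
pieces : ℕ → List LStep → List (List LStep) × List LStep
pieces zero    s = [] , s
pieces (suc k) s with firstReturn 0 s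
... | (L₁ , rest) = cons₁ L₁ (pieces k rest)

-- ψ with a fuel argument (fuel = length of the path suffices, since
-- every recursive call is on a strictly shorter path).
ψ-fuel : ℕ → List LStep → List MStep
ψ-fuel zero    _          = []
ψ-fuel (suc n) []         = []
ψ-fuel (suc n) (F ∷ s)    = F ∷ ψ-fuel n s
ψ-fuel (suc n) (D ∷ s)    = []    -- not a Łukasiewicz path; junk value
ψ-fuel (suc n) (U↑ k ∷ s) with pieces (suc k) s
... | (Ls , L) =
  U ∷ (concat (intersperse [ F ] (map (ψ-fuel n) Ls)) ++ (D ∷ ψ-fuel n L))

-- ψ(ε) = ε, ψ(F L) = F ψ(L),
-- ψ(U_k L₁ D L₂ D ⋯ L_k D L) = U ψ(L₁) F ψ(L₂) F ⋯ F ψ(L_k) D ψ(L).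
ψ : List LStep → List MStep
ψ s = ψ-fuel (length s) s

-- ψ is computed by a left-to-right stack transducer ψ-stack: U_{j+1} emits U and
-- pushes j, F is copied, and D emits D when it pops a 0 but F when it decrements a
-- positive top.  An entry j thus counts the closing D's of an open up step that
-- are still to become separators, and in U_k L₁ D ⋯ L_k D these are exactly the
-- first k − 1 of them, so ψ = ψ-stack [].  Reading a Motzkin path backwards
-- rebuilds the stack (unψ).  Without flat steps at positive height an emitted F
-- comes from a flat step exactly when the stack is empty, so unψ inverts
-- ψ-stack; and on UU-free paths every rebuilt up step is followed by D, so unψ
-- lands in 𝒞_n.
module Submission where

open import Defs
open import Data.Nat using (ℕ; zero; suc; _+_; _≤_)
open import Data.Nat.Properties using (suc-injective; +-assoc; +-identityʳ; ≤-pred; ≤-refl; ≤-trans; n≤1+n; m+n≤o⇒m≤o; m+n≤o⇒n≤o)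
open import Data.List using (List; []; _∷_; _++_; length; map; concat; intersperse; [_]; foldr)
open import Data.List.Properties using (++-assoc; ++-identityʳ; length-++; map-cong-local)
open import Data.List.Relation.Unary.All using (All; []; _∷_)
open import Data.Product using (_×_; _,_; ∃-syntax; proj₂; uncurry)
open import Data.Unit using (tt)
open import Data.Empty using (⊥-elim)
open import Relation.Nullary using (¬_)
open import Relation.Binary.PropositionalEquality using (_≡_; refl; sym; trans; cong; cong₂; subst; module ≡-Reasoning)

height : List ℕ → ℕ
height []       = 0
height (j ∷ st) = suc j + height st

ψ-stack : List ℕ → List LStep → List MStep
ψ-stack st           []         = []
ψ-stack st           (F ∷ s)    = F ∷ ψ-stack st s
ψ-stack st           (U↑ j ∷ s) = U ∷ ψ-stack (j ∷ st) s
ψ-stack []           (D ∷ s)    = D ∷ ψ-stack [] s    -- junk: never reached on a walk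
ψ-stack (zero ∷ st)  (D ∷ s)    = D ∷ ψ-stack st s
ψ-stack (suc j ∷ st) (D ∷ s)    = F ∷ ψ-stack (j ∷ st) s

length-ψ-stack : ∀ st s → length (ψ-stack st s) ≡ length s
length-ψ-stack st           []         = refl
length-ψ-stack st           (F ∷ s)    = cong suc (length-ψ-stack st s)
length-ψ-stack st           (U↑ j ∷ s) = cong suc (length-ψ-stack (j ∷ st) s)
length-ψ-stack []           (D ∷ s)    = cong suc (length-ψ-stack [] s)
length-ψ-stack (zero ∷ st)  (D ∷ s)    = cong suc (length-ψ-stack st s)
length-ψ-stack (suc j ∷ st) (D ∷ s)    = cong suc (length-ψ-stack (j ∷ st) s)

ψ-stack-walk : ∀ st {s} → Walk (height st) s → Walk (length st) (map embed (ψ-stack st s))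
ψ-stack-walk []           end                = end
ψ-stack-walk (_ ∷ _)      {[]}               ()
ψ-stack-walk st           (stepF w)          = stepF (ψ-stack-walk st w)
ψ-stack-walk st           (stepU {k = j} w)  = stepU (ψ-stack-walk (j ∷ st) w)
ψ-stack-walk (zero ∷ st)  (stepD w)          = stepD (ψ-stack-walk st w)
ψ-stack-walk (suc j ∷ st) (stepD w)          = stepF (ψ-stack-walk (j ∷ st) w)

ψ-stack-noUU : ∀ st s → UpThenD s → NoUU (ψ-stack st s)
ψ-stack-noUU st           []                  _  = tt
ψ-stack-noUU st           (F ∷ s)             u  = ψ-stack-noUU st s u
ψ-stack-noUU []           (D ∷ s)             u  = ψ-stack-noUU [] s u
ψ-stack-noUU (zero ∷ st)  (D ∷ s)             u  = ψ-stack-noUU st s u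
ψ-stack-noUU (suc j ∷ st) (D ∷ s)             u  = ψ-stack-noUU (j ∷ st) s u
ψ-stack-noUU st           (U↑ zero ∷ D ∷ s)    u  = ψ-stack-noUU st s u
ψ-stack-noUU st           (U↑ (suc j) ∷ D ∷ s) u  = ψ-stack-noUU (j ∷ st) s u

ψ-stack-++ : ∀ st′ st {P} R → Walk (height st′) P →
             ψ-stack (st′ ++ st) (P ++ R) ≡ ψ-stack st′ P ++ ψ-stack st R
ψ-stack-++ []            st R end               = refl
ψ-stack-++ (_ ∷ _)       st {[]} R ()
ψ-stack-++ st′           st R (stepF w)         = cong (F ∷_) (ψ-stack-++ st′ st R w)
ψ-stack-++ st′           st R (stepU {k = j} w) = cong (U ∷_) (ψ-stack-++ (j ∷ st′) st R w)
ψ-stack-++ (zero ∷ st′)  st R (stepD w)         = cong (D ∷_) (ψ-stack-++ st′ st R w)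
ψ-stack-++ (suc j ∷ st′) st R (stepD w)         = cong (F ∷_) (ψ-stack-++ (j ∷ st′) st R w)

firstReturn-++ : ∀ {h P} R → Walk h P → firstReturn h (P ++ D ∷ R) ≡ (P , R)
firstReturn-++         R end       = refl
firstReturn-++         R (stepD w) rewrite firstReturn-++ R w = refl
firstReturn-++ {zero}  R (stepF w) rewrite firstReturn-++ R w = refl
firstReturn-++ {suc h} R (stepF w) rewrite firstReturn-++ R w = refl
firstReturn-++ {zero}  R (stepU w) rewrite firstReturn-++ R w = refl
firstReturn-++ {suc h} R (stepU w) rewrite firstReturn-++ R w = refl

Walk-split : ∀ {H s} → Walk H s → ∀ m h → H ≡ m + suc h →
             ∃[ P ] ∃[ R ] (s ≡ P ++ D ∷ R × Walk m P × Walk h R)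
Walk-split end zero    h ()
Walk-split end (suc m) h ()
Walk-split (stepD {s = s} w) zero h refl = [] , s , refl , end , w
Walk-split (stepD w) (suc m) h e with Walk-split w m h (suc-injective e)
... | P , R , refl , wP , wR = D ∷ P , R , refl , stepD wP , wR
Walk-split (stepF w) m h e with Walk-split w m h e
... | P , R , refl , wP , wR = F ∷ P , R , refl , stepF wP , wR
Walk-split (stepU {k = k} w) m h e with Walk-split w (suc k + m) h (trans (cong (suc k +_) e) (sym (+-assoc (suc k) m (suc h))))
... | P , R , refl , wP , wR = U↑ k ∷ P , R , refl , stepU wP , wR

glue : List (List LStep) → List LStep → List LStep
glue []       L = L
glue (P ∷ Ls) L = P ++ D ∷ glue Ls L

Walk-glue : ∀ k {s} → Walk k s →
            ∃[ Ls ] ∃[ L ] (s ≡ glue Ls L × length Ls ≡ k × All (Walk 0) Ls × Walk 0 L)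
Walk-glue zero    w = [] , _ , refl , refl , [] , w
Walk-glue (suc k) w with Walk-split w 0 k refl
... | P , R , refl , wP , wR with Walk-glue k wR
... | Ls , L , refl , len , ws , wL = P ∷ Ls , L , refl , cong suc len , wP ∷ ws , wL

pieces-glue : ∀ {k L} Ls → length Ls ≡ k → All (Walk 0) Ls → pieces k (glue Ls L) ≡ (Ls , L)
pieces-glue         []       refl []        = refl
pieces-glue {L = L} (P ∷ Ls) refl (wP ∷ ws)
  rewrite firstReturn-++ (glue Ls L) wP | pieces-glue {L = L} Ls refl ws = refl

ψ-stack-glue : ∀ {k} st Ls L → length Ls ≡ suc k → All (Walk 0) Ls →
  ψ-stack (k ∷ st) (glue Ls L) ≡ concat (intersperse [ F ] (map (ψ-stack []) Ls)) ++ D ∷ ψ-stack st L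
ψ-stack-glue st (P ∷ []) L refl (wP ∷ []) = begin
    ψ-stack (0 ∷ st) (P ++ D ∷ L)   ≡⟨ ψ-stack-++ [] (0 ∷ st) (D ∷ L) wP ⟩
    ψ-stack [] P ++ D ∷ ψ-stack st L ≡⟨ cong (_++ D ∷ ψ-stack st L) (sym (++-identityʳ (ψ-stack [] P))) ⟩
    (ψ-stack [] P ++ []) ++ D ∷ ψ-stack st L ∎
  where open ≡-Reasoning
ψ-stack-glue st (P ∷ Q ∷ Ls) L refl (wP ∷ ws) = begin
    ψ-stack (suc k ∷ st) (P ++ D ∷ glue (Q ∷ Ls) L)
  ≡⟨ ψ-stack-++ [] (suc k ∷ st) (D ∷ glue (Q ∷ Ls) L) wP ⟩
    ψ-stack [] P ++ F ∷ ψ-stack (k ∷ st) (glue (Q ∷ Ls) L)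
  ≡⟨ cong (λ x → ψ-stack [] P ++ F ∷ x) (ψ-stack-glue st (Q ∷ Ls) L refl ws) ⟩
    ψ-stack [] P ++ F ∷ (rest ++ D ∷ ψ-stack st L)
  ≡⟨ sym (++-assoc (ψ-stack [] P) (F ∷ rest) (D ∷ ψ-stack st L)) ⟩
    (ψ-stack [] P ++ F ∷ rest) ++ D ∷ ψ-stack st L
  ∎
  where
  open ≡-Reasoning
  k = length Ls
  rest = concat (intersperse [ F ] (map (ψ-stack []) (Q ∷ Ls)))

++-∷-length≤ : ∀ {A : Set} {n} (P : List A) {x R} → length (P ++ x ∷ R) ≤ n → length P ≤ n × length R ≤ n
++-∷-length≤ P {R = R} le =
  m+n≤o⇒m≤o (length P) le′ , ≤-trans (n≤1+n (length R)) (m+n≤o⇒n≤o (length P) le′)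
  where le′ = subst (_≤ _) (length-++ P) le

ψ-fuel-agrees : ∀ n {s} → length s ≤ n → Walk 0 s → ψ-fuel n s ≡ ψ-stack [] s
ψ-fuel-agrees zero    {[]}         _  _ = refl
ψ-fuel-agrees zero    {_ ∷ _}      () _
ψ-fuel-agrees (suc n) {[]}         _  _ = refl
ψ-fuel-agrees (suc n) {F ∷ s}      le (stepF w) = cong (F ∷_) (ψ-fuel-agrees n (≤-pred le) w)
ψ-fuel-agrees (suc n) {U↑ k ∷ s}   le (stepU w)
  with Walk-glue (suc k) (subst (λ h → Walk h s) (+-identityʳ (suc k)) w)
... | Ls , L , refl , len , ws , wL = begin
    ψ-fuel (suc n) (U↑ k ∷ glue Ls L)
  ≡⟨ cong (uncurry λ Ms M → U ∷ (joinF (map (ψ-fuel n) Ms) ++ D ∷ ψ-fuel n M)) (pieces-glue Ls len ws) ⟩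
    U ∷ (joinF (map (ψ-fuel n) Ls) ++ D ∷ ψ-fuel n L)
  ≡⟨ cong₂ (λ Ms M → U ∷ (joinF Ms ++ D ∷ M))
           (map-cong-local (pieces-agree Ls (≤-pred le) ws))
           (ψ-fuel-agrees n (tail-bound Ls (≤-pred le)) wL) ⟩
    U ∷ (joinF (map (ψ-stack []) Ls) ++ D ∷ ψ-stack [] L)
  ≡⟨ cong (U ∷_) (sym (ψ-stack-glue [] Ls L len ws)) ⟩
    U ∷ ψ-stack (k ∷ []) (glue Ls L)
  ∎
  where
  open ≡-Reasoning

  joinF : List (List MStep) → List MStep
  joinF Ms = concat (intersperse [ F ] Ms)

  pieces-agree : ∀ Ms → length (glue Ms L) ≤ n → All (Walk 0) Ms →
                 All (λ P → ψ-fuel n P ≡ ψ-stack [] P) Ms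
  pieces-agree []       _  []        = []
  pieces-agree (P ∷ Ms) le (wP ∷ ws) with ++-∷-length≤ P le
  ... | leP , leMs = ψ-fuel-agrees n leP wP ∷ pieces-agree Ms leMs ws

  tail-bound : ∀ Ms → length (glue Ms L) ≤ n → length L ≤ n
  tail-bound []       le = le
  tail-bound (P ∷ Ms) le = tail-bound Ms (proj₂ (++-∷-length≤ P le))

ψ≡ψ-stack : ∀ {s} → Walk 0 s → ψ s ≡ ψ-stack [] s
ψ≡ψ-stack {s} = ψ-fuel-agrees (length s) ≤-refl

unψ-step : MStep → List ℕ × List LStep → List ℕ × List LStep
unψ-step F ([]     , s) = []         , F ∷ s
unψ-step F (j ∷ st , s) = suc j ∷ st , D ∷ s
unψ-step D (st     , s) = zero ∷ st  , D ∷ s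
unψ-step U ([]     , s) = []         , s              -- junk: never reached on a walk
unψ-step U (j ∷ st , s) = st         , U↑ j ∷ s

unψ : List MStep → List ℕ × List LStep
unψ = foldr unψ-step ([] , [])

unψ-ψ-stack : ∀ st {s} → Walk (height st) s → NoFlatPos (height st) s → unψ (ψ-stack st s) ≡ (st , s)
unψ-ψ-stack []           end               _        = refl
unψ-ψ-stack (_ ∷ _)      {[]}              ()       _
unψ-ψ-stack []           (stepF w)         (_ , nf) rewrite unψ-ψ-stack [] w nf = refl
unψ-ψ-stack (_ ∷ _)      (stepF w)         (() , _)
unψ-ψ-stack st           (stepU {k = j} w) nf       rewrite unψ-ψ-stack (j ∷ st) w nf = refl
unψ-ψ-stack (zero ∷ st)  (stepD w)         nf       rewrite unψ-ψ-stack st w nf = refl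
unψ-ψ-stack (suc j ∷ st) (stepD w)         nf       rewrite unψ-ψ-stack (j ∷ st) w nf = refl

Decodes : ℕ → List MStep → List ℕ × List LStep → Set
Decodes h m (st , s) =
  length st ≡ h × ψ-stack st s ≡ m × Walk (height st) s × NoFlatPos (height st) s × UpThenD s

Decodes-U : ∀ {h x m} p → ¬ x ≡ U → Decodes (suc h) (x ∷ m) p → Decodes h (U ∷ x ∷ m) (unψ-step U p)
Decodes-U ([]     , _)          _   (() , _)
Decodes-U (_ ∷ _  , [])         _   (_ , () , _)
Decodes-U (_ ∷ _  , F ∷ _)      _   (_ , _ , _ , (() , _) , _)
Decodes-U (_ ∷ _  , U↑ _ ∷ _)   x≢U (_ , refl , _) = ⊥-elim (x≢U refl)
Decodes-U (j ∷ st , D ∷ s)      _   (len , eq , w , nf , ud) =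
  suc-injective len , cong (U ∷_) eq , stepU w , nf , ud

unψ-decodes : ∀ {h} m → Walk h (map embed m) → NoUU m → Decodes h m (unψ m)
unψ-decodes [] end _ = refl , refl , end , tt , tt
unψ-decodes (F ∷ m) (stepF w) nu with unψ m | unψ-decodes m w nu
... | []     , s | len , eq , ws , nf , ud = len , cong (F ∷_) eq , stepF ws , (refl , nf) , ud
... | _ ∷ _  , s | len , eq , ws , nf , ud = len , cong (F ∷_) eq , stepD ws , nf , ud
unψ-decodes (D ∷ m) (stepD w) nu with unψ m | unψ-decodes m w nu
... | _ , _ | len , eq , ws , nf , ud = cong suc len , cong (D ∷_) eq , stepD ws , nf , ud
unψ-decodes (U ∷ [])    (stepU ())   _
unψ-decodes (U ∷ F ∷ m) (stepU w) nu = Decodes-U (unψ (F ∷ m)) (λ ()) (unψ-decodes (F ∷ m) w nu)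
unψ-decodes (U ∷ D ∷ m) (stepU w) nu = Decodes-U (unψ (D ∷ m)) (λ ()) (unψ-decodes (D ∷ m) w nu)

theorem9 : (n : ℕ) →
    ((s : List LStep) → InC n s → InM n (ψ s))
    × ((s t : List LStep) → InC n s → InC n t → ψ s ≡ ψ t → s ≡ t)
    × ((m : List MStep) → InM n m → ∃[ s ] (InC n s × ψ s ≡ m))
theorem9 n = into , injective , onto
  where
  into : (s : List LStep) → InC n s → InM n (ψ s)
  into s ((len , w) , _ , ud) rewrite ψ≡ψ-stack w =
    (trans (length-ψ-stack [] s) len , ψ-stack-walk [] w) , ψ-stack-noUU [] s ud

  injective : (s t : List LStep) → InC n s → InC n t → ψ s ≡ ψ t → s ≡ t
  injective s t ((_ , ws) , nfs , _) ((_ , wt) , nft , _) eq = cong proj₂ (begin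
      ([] , s)               ≡⟨ sym (unψ-ψ-stack [] ws nfs) ⟩
      unψ (ψ-stack [] s)     ≡⟨ cong unψ (trans (sym (ψ≡ψ-stack ws)) (trans eq (ψ≡ψ-stack wt))) ⟩
      unψ (ψ-stack [] t)     ≡⟨ unψ-ψ-stack [] wt nft ⟩
      ([] , t)               ∎)
    where open ≡-Reasoning

  onto : (m : List MStep) → InM n m → ∃[ s ] (InC n s × ψ s ≡ m)
  onto m ((len , w) , nu) with unψ m | unψ-decodes m w nu
  ... | [] , s | _ , eq , ws , nf , ud =
    s , ((trans (sym (length-ψ-stack [] s)) (trans (cong length eq) len) , ws) , nf , ud) ,
    trans (ψ≡ψ-stack ws) eq
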